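{- There exist infinitely many graphs $G$ for which $\operatorname{th}_c^{\times}(G)$ is not achieved by any set of size $\gamma(G)$ nor by any set of size $c(G)$, i.e., $\operatorname{th}_c^{\times}(G,\gamma(G))>\operatorname{th}_c^{\times}(G)$ and $\operatorname{th}_c^{\times}(G,c(G))>\operatorname{th}_c^{\times}(G)$. In particular, this is the case for $G=M(\ell)$ for every $\ell\ge 7$.
   Context: For a positive integer $\ell$, $M'(\ell)$ is obtained from the disjoint union of a $4$-cycle $C_4$ and three copies of the path $P_\ell$ by pairing the three paths with three distinct vertices of $C_4$ and adding an edge from an endpoint of each path to its paired vertex of $C_4$; $M(\ell)$ is obtained from $M'(\ell)$ by attaching a new leaf to every vertex of $M'(\ell)$ (so $M(\ell)$ has $6\ell+8$ vertices). $\gamma(G)$ is the domination number and $c(G)$ the cop number. In the game of Cops and Robbers, the cops first occupy a multiset $S$ of vertices, then the robber chooses a vertex; in each round every cop moves to an adjacent vertex or stays, then the robber does likewise; perfect information; capture occurs when a cop occupies the robber's vertex; $c(G)$ is the minimum number of cops guaranteeing capture. $\operatorname{capt}(G;S)$ is the optimal-play number of rounds to capture with cops starting on $S$ ($\infty$ if not guaranteed). $\operatorname{th}_c^{\times}(G;S)=|S|(1+\operatorname{capt}(G;S))$, $\operatorname{th}_c^{\times}(G,k)=\min_{|S|=k}\operatorname{th}_c^{\times}(G;S)$, and $\operatorname{th}_c^{\times}(G)=\min_k\operatorname{th}_c^{\times}(G,k)$. -}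

module Defs where

open import Level using (0ℓ)
open import Data.Nat using (ℕ; zero; suc; _+_; _*_; _≤_; _<_)
open import Data.Fin using (Fin; toℕ; inject₁; #_)
open import Data.Sum using (_⊎_; inj₁; inj₂)
open import Data.Product using (Σ; ∃; ∃-syntax; _×_; _,_)
open import Data.Empty using (⊥)
open import Relation.Nullary using (¬_)
open import Relation.Binary.PropositionalEquality using (_≡_)

record Graph : Set₁ where
  field
    V   : Set
    Adj : V → V → Set

open Graph public

N[_]∋ : (G : Graph) → V G → V G → Set
N[ G ]∋ v w = (v ≡ w) ⊎ Adj G v w

data Base (ℓ : ℕ) : Set where
  cyc : Fin 4 → Base ℓ
  pth : Fin 3 → Fin ℓ → Base ℓ

-- directed edge list of M'(ℓ); the graph is its symmetric closure
data E (ℓ : ℕ) : Base ℓ → Base ℓ → Set where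
  c01 : E ℓ (cyc (# 0)) (cyc (# 1))
  c12 : E ℓ (cyc (# 1)) (cyc (# 2))
  c23 : E ℓ (cyc (# 2)) (cyc (# 3))
  c30 : E ℓ (cyc (# 3)) (cyc (# 0))
  pp  : (a : Fin 3) (i j : Fin ℓ) → toℕ j ≡ suc (toℕ i) → E ℓ (pth a i) (pth a j)
  att : (a : Fin 3) (i : Fin ℓ) → toℕ i ≡ 0 → E ℓ (pth a i) (cyc (inject₁ a))

M′ : ℕ → Graph
M′ ℓ = record { V = Base ℓ ; Adj = λ x y → E ℓ x y ⊎ E ℓ y x }

-- M(ℓ): inj₁ x is the vertex x of M'(ℓ), inj₂ x is the new leaf attached to x
MAdj : (ℓ : ℕ) → Base ℓ ⊎ Base ℓ → Base ℓ ⊎ Base ℓ → Set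
MAdj ℓ (inj₁ x) (inj₁ y) = Adj (M′ ℓ) x y
MAdj ℓ (inj₁ x) (inj₂ y) = x ≡ y
MAdj ℓ (inj₂ x) (inj₁ y) = x ≡ y
MAdj ℓ (inj₂ x) (inj₂ y) = ⊥

M : ℕ → Graph
M ℓ = record { V = Base ℓ ⊎ Base ℓ ; Adj = MAdj ℓ }

-- a (multi)set of d vertices, given as a d-tuple
Dominating : (G : Graph) {d : ℕ} → (Fin d → V G) → Set
Dominating G {d} S = ∀ v → ∃[ i ] N[ G ]∋ (S i) v

IsDominationNumber : Graph → ℕ → Set
IsDominationNumber G d =
  (Σ (Fin d → V G) λ S → Dominating G S) ×
  (∀ d′ → d′ < d → ¬ (Σ (Fin d′ → V G) λ S → Dominating G S))

Caught : (G : Graph) {k : ℕ} → (Fin k → V G) → V G → Set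
Caught G C r = ∃[ i ] C i ≡ r

CopMove : (G : Graph) {k : ℕ} → (Fin k → V G) → (Fin k → V G) → Set
CopMove G C C′ = ∀ i → N[ G ]∋ (C i) (C′ i)

-- WinWithin G t C r : cops at C, robber at r, cops to move;
-- cops can guarantee capture within t further rounds.
WinWithin : (G : Graph) {k : ℕ} → ℕ → (Fin k → V G) → V G → Set
WinWithin G zero    C r = Caught G C r
WinWithin G (suc t) C r =
  Caught G C r ⊎
  (Σ (Fin _ → V G) λ C′ → CopMove G C C′ ×
     (Caught G C′ r ⊎ (∀ r′ → N[ G ]∋ r r′ → WinWithin G t C′ r′)))

CaptLe : (G : Graph) {k : ℕ} → (Fin k → V G) → ℕ → Set
CaptLe G S t = ∀ r → WinWithin G t S r

CanCapture : Graph → ℕ → Set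
CanCapture G k = Σ (Fin k → V G) λ S → ∃[ t ] CaptLe G S t

IsCopNumber : Graph → ℕ → Set
IsCopNumber G c = CanCapture G c × (∀ c′ → c′ < c → ¬ CanCapture G c′)

-- Throttling numbers th_c^×, expressed through "≤ m" (values in ℕ ∪ {∞})

ThSLe : (G : Graph) {k : ℕ} → (Fin k → V G) → ℕ → Set
ThSLe G {k} S m = ∃[ t ] (CaptLe G S t × k * (1 + t) ≤ m)

ThkLe : Graph → ℕ → ℕ → Set
ThkLe G k m = Σ (Fin k → V G) λ S → ThSLe G S m

ThLe : Graph → ℕ → Set
ThLe G m = ∃[ k ] ThkLe G k m

ThkGtTh : Graph → ℕ → Set
ThkGtTh G k = ∃[ m ] (ThLe G m × ¬ ThkLe G k m)

-- Three cops standing at depth d on the three legs of M ℓ catch the robber within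
-- T rounds as soon as T ≥ d + 2 and d + T ≥ ℓ + 1: a robber no deeper than the cops
-- is swept into the 4-cycle by all cops descending in step, and a robber beyond a cop
-- is chased up its leg. With d ≈ ℓ/2 this gives th(M ℓ) ≤ 3 (T + 1) ≈ 3ℓ/2.
-- On the other side, the 3ℓ leaves hanging from the paths need distinct dominators,
-- so th(M ℓ, γ) ≥ γ ≥ 3ℓ. Finally c(M ℓ) = 2: M ℓ retracts onto C₄, so one cop
-- loses, and two cops win; but a cop that does not start on a leg needs more than
-- ℓ + 1 rounds to reach the robber hiding at the leaf at the far end of that leg,
-- and two cops cannot start on all three legs, whence th(M ℓ, 2) ≥ 2 (ℓ + 3).
module Submission where

open import Defs
open import Data.Nat
  using (ℕ; zero; suc; _+_; _*_; _∸_; _≤_; _<_; _≤′_; z≤n; s≤s; s≤s⁻¹; z<s; _≤?_; _<?_)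
open import Data.Nat.Properties
open import Data.Fin using (Fin; toℕ; inject₁; fromℕ; fromℕ<; #_; remQuot; combine)
  renaming (zero to fzero; suc to fsuc)
import Data.Fin.Properties as Fin
open import Data.Vec.Functional using (updateAt)
open import Data.Vec.Functional.Properties using (updateAt-updates; updateAt-minimal)
open import Data.Sum using (_⊎_; inj₁; inj₂; [_,_]′; swap)
open import Data.Product using (∃-syntax; _×_; _,_; proj₁; proj₂; uncurry)
open import Data.Bool using (if_then_else_)
open import Data.Empty using (⊥)
open import Function using (const; _∘_; Injective)
open import Relation.Nullary using (¬_; yes; no; does; contradiction)
open import Relation.Nullary.Decidable using (from-yes)
open import Relation.Binary.Definitions using (tri<; tri≈; tri>)
open import Relation.Binary.PropositionalEquality

Homomorphism : (G H : Graph) → (V G → V H) → Set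
Homomorphism G H f = ∀ {u v} → N[ G ]∋ u v → N[ H ]∋ (f u) (f v)

Lipschitz : (G : Graph) → (V G → ℕ) → Set
Lipschitz G f = ∀ {u v} → N[ G ]∋ u v → f v ≤ suc (f u)

-- Cops and robber on an arbitrary graph

module _ {G : Graph} {m : ℕ} where

  moveCop : (Fin m → V G) → Fin m → V G → Fin m → V G
  moveCop C z x = updateAt C z (const x)

  moveCop-moves : ∀ C z x → moveCop C z x z ≡ x
  moveCop-moves C z x = updateAt-updates z C

  moveCop-legal : ∀ C z {x} → N[ G ]∋ (C z) x → CopMove G C (moveCop C z x)
  moveCop-legal C z {x} zx i with i Fin.≟ z
  ... | yes refl = subst (N[ G ]∋ (C z)) (sym (moveCop-moves C z x)) zx
  ... | no i≢z = inj₁ (sym (updateAt-minimal i z C i≢z))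

  caught⇒winWithin : ∀ t {C : Fin m → V G} {r} → Caught G C r → WinWithin G t C r
  caught⇒winWithin zero    caught = caught
  caught⇒winWithin (suc t) caught = inj₁ caught

  winWithin-suc : ∀ t {C : Fin m → V G} {r} → WinWithin G t C r → WinWithin G (suc t) C r
  winWithin-suc zero    caught                         = inj₁ caught
  winWithin-suc (suc t) (inj₁ caught)                  = inj₁ caught
  winWithin-suc (suc t) (inj₂ (C′ , mv , inj₁ caught)) = inj₂ (C′ , mv , inj₁ caught)
  winWithin-suc (suc t) (inj₂ (C′ , mv , inj₂ next))   =
    inj₂ (C′ , mv , inj₂ λ r′ rr′ → winWithin-suc t (next r′ rr′))

  winWithin-mono : ∀ {s t} {C : Fin m → V G} {r} → s ≤ t → WinWithin G s C r → WinWithin G t C r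
  winWithin-mono = mono′ ∘ ≤⇒≤′
    where
    mono′ : ∀ {s t} {C : Fin m → V G} {r} → s ≤′ t → WinWithin G s C r → WinWithin G t C r
    mono′ (_≤′_.≤′-reflexive refl) win = win
    mono′ (_≤′_.≤′-step s≤′t)      win = winWithin-suc _ (mono′ s≤′t win)

  adjacent⇒winWithin : ∀ t {C : Fin m → V G} {r c} z → C z ≡ c → N[ G ]∋ c r →
                       WinWithin G (suc t) C r
  adjacent⇒winWithin t {C} {r} z refl zr =
    inj₂ (moveCop C z r , moveCop-legal C z zr , inj₁ (z , moveCop-moves C z r))

  chase : ∀ t {C : Fin m → V G} {r c x} z (P : V G → Set) → C z ≡ c → N[ G ]∋ c x →
          (∀ {r′} → N[ G ]∋ r r′ → r′ ≡ x ⊎ P r′) →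
          (∀ {r′} → P r′ → WinWithin G t (moveCop C z x) r′) →
          WinWithin G (suc t) C r
  chase t {C} {x = x} z P refl zx escape win =
    inj₂ (moveCop C z x , moveCop-legal C z zx , inj₂ λ r′ rr′ →
      [ (λ r′≡x → caught⇒winWithin t (z , trans (moveCop-moves C z x) (sym r′≡x))) , win ]′
        (escape rr′))

  winWithin⇒lipschitz-bound : ∀ {f} → Lipschitz G f → ∀ t {C : Fin m → V G} {r} →
    WinWithin G t C r → ∃[ z ] f r ≤ f (C z) + t
  winWithin⇒lipschitz-bound lip zero    (z , refl)        = z , ≤-reflexive (sym (+-identityʳ _))
  winWithin⇒lipschitz-bound lip (suc t) (inj₁ (z , refl)) = z , m≤m+n _ _
  winWithin⇒lipschitz-bound {f} lip (suc t) {C} (inj₂ (C′ , mv , inj₁ (z , refl))) =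
    z , ≤-trans (lip (mv z)) (m<m+n (f (C z)) z<s)
  winWithin⇒lipschitz-bound {f} lip (suc t) {C} {r} (inj₂ (C′ , mv , inj₂ next))
    with winWithin⇒lipschitz-bound lip t (next r (inj₁ refl))
  ... | z , bound = z , ≤-trans bound (≤-trans (+-monoˡ-≤ t (lip (mv z)))
                                               (≤-reflexive (sym (+-suc (f (C z)) t))))

no-cops-no-capture : ∀ {G} t (C : Fin 0 → V G) r → ¬ WinWithin G t C r
no-cops-no-capture zero    C r (() , _)
no-cops-no-capture (suc t) C r (inj₁ (() , _))
no-cops-no-capture (suc t) C r (inj₂ (_ , _ , inj₁ (() , _)))
no-cops-no-capture (suc t) C r (inj₂ (C′ , _ , inj₂ next)) =
  no-cops-no-capture t C′ r (next r (inj₁ refl))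

zero-cops-lose : ∀ {G} → V G → ¬ CanCapture G 0
zero-cops-lose r (S , t , capt) = no-cops-no-capture t S r (capt r)

isCopNumber-unique : ∀ {G c c′} → IsCopNumber G c → IsCopNumber G c′ → c ≡ c′
isCopNumber-unique {c = c} {c′} (win , least) (win′ , least′) with <-cmp c c′
... | tri< c<c′ _ _ = contradiction win (least′ c c<c′)
... | tri≈ _ c≡c′ _ = c≡c′
... | tri> _ _ c′<c = contradiction win′ (least c′ c′<c)

thk-lower-bound : ∀ {G k b n} → (∀ S t → CaptLe G S t → b ≤ k * suc t) → n < b → ¬ ThkLe G k n
thk-lower-bound bound n<b (S , t , capt , cost≤n) = <⇒≱ n<b (≤-trans (bound S t capt) cost≤n)

-- Retracts of the 4-cycle

data C₄-Edge : Fin 4 → Fin 4 → Set where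
  e01 : C₄-Edge (# 0) (# 1)
  e12 : C₄-Edge (# 1) (# 2)
  e23 : C₄-Edge (# 2) (# 3)
  e30 : C₄-Edge (# 3) (# 0)

C₄ : Graph
C₄ = record { V = Fin 4 ; Adj = λ x y → C₄-Edge x y ⊎ C₄-Edge y x }

opposite : Fin 4 → Fin 4
opposite fzero                      = # 2
opposite (fsuc fzero)               = # 3
opposite (fsuc (fsuc fzero))        = # 0
opposite (fsuc (fsuc (fsuc fzero))) = # 1

opposite-involutive : ∀ x → opposite (opposite x) ≡ x
opposite-involutive fzero                      = refl
opposite-involutive (fsuc fzero)               = refl
opposite-involutive (fsuc (fsuc fzero))        = refl
opposite-involutive (fsuc (fsuc (fsuc fzero))) = refl

opposite-hom : Homomorphism C₄ C₄ opposite
opposite-hom (inj₁ refl)       = inj₁ refl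
opposite-hom (inj₂ (inj₁ e01)) = inj₂ (inj₁ e23)
opposite-hom (inj₂ (inj₁ e12)) = inj₂ (inj₁ e30)
opposite-hom (inj₂ (inj₁ e23)) = inj₂ (inj₁ e01)
opposite-hom (inj₂ (inj₁ e30)) = inj₂ (inj₁ e12)
opposite-hom (inj₂ (inj₂ e01)) = inj₂ (inj₂ e23)
opposite-hom (inj₂ (inj₂ e12)) = inj₂ (inj₂ e30)
opposite-hom (inj₂ (inj₂ e23)) = inj₂ (inj₂ e01)
opposite-hom (inj₂ (inj₂ e30)) = inj₂ (inj₂ e12)

opposite-far : ∀ x → ¬ N[ C₄ ]∋ (opposite x) x
opposite-far fzero                      (inj₁ ())
opposite-far fzero                      (inj₂ (inj₁ ()))
opposite-far fzero                      (inj₂ (inj₂ ()))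
opposite-far (fsuc fzero)               (inj₁ ())
opposite-far (fsuc fzero)               (inj₂ (inj₁ ()))
opposite-far (fsuc fzero)               (inj₂ (inj₂ ()))
opposite-far (fsuc (fsuc fzero))        (inj₁ ())
opposite-far (fsuc (fsuc fzero))        (inj₂ (inj₁ ()))
opposite-far (fsuc (fsuc fzero))        (inj₂ (inj₂ ()))
opposite-far (fsuc (fsuc (fsuc fzero))) (inj₁ ())
opposite-far (fsuc (fsuc (fsuc fzero))) (inj₂ (inj₁ ()))
opposite-far (fsuc (fsuc (fsuc fzero))) (inj₂ (inj₂ ()))

module _ {G : Graph} (ρ : V G → Fin 4) (σ : Fin 4 → V G)
         (ρ-hom : Homomorphism G C₄ ρ) (σ-hom : Homomorphism C₄ G σ)
         (ρ∘σ : ∀ x → ρ (σ x) ≡ x) where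

  private
    unreachable : ∀ {c c′ x} → ρ c ≡ opposite x → N[ G ]∋ c c′ → c′ ≢ σ x
    unreachable {x = x} ρc cc′ refl =
      opposite-far x (subst₂ (N[_]∋ C₄) ρc (ρ∘σ x) (ρ-hom cc′))

    -- The robber stays on σ of the vertex of C₄ opposite to the image of the cop.
    evade : ∀ t (C : Fin 1 → V G) x → ρ (C fzero) ≡ opposite x → ¬ WinWithin G t C (σ x)
    evade zero    C x ρC (fzero , caught)                         = unreachable ρC (inj₁ refl) caught
    evade (suc t) C x ρC (inj₁ (fzero , caught))                  = unreachable ρC (inj₁ refl) caught
    evade (suc t) C x ρC (inj₂ (C′ , mv , inj₁ (fzero , caught))) = unreachable ρC (mv fzero) caught
    evade (suc t) C x ρC (inj₂ (C′ , mv , inj₂ next)) =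
      evade t C′ (opposite y) (sym (opposite-involutive y)) (next (σ (opposite y)) (σ-hom escape))
      where
      y = ρ (C′ fzero)
      escape : N[ C₄ ]∋ x (opposite y)
      escape = subst (λ w → N[ C₄ ]∋ w (opposite y)) (opposite-involutive x)
                 (opposite-hom (subst (λ w → N[ C₄ ]∋ w y) ρC (ρ-hom (mv fzero))))

  retract-C₄⇒one-cop-loses : ¬ CanCapture G 1
  retract-C₄⇒one-cop-loses (S , t , capt) =
    evade t S (opposite (ρ (S fzero))) (sym (opposite-involutive _)) (capt _)

-- The graph M ℓ

module _ {ℓ : ℕ} where

  base : V (M ℓ) → Base ℓ
  base (inj₁ v) = v
  base (inj₂ v) = v

  base-hom : Homomorphism (M ℓ) (M′ ℓ) base
  base-hom (inj₁ refl)                  = inj₁ refl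
  base-hom {inj₁ _} {inj₁ _} (inj₂ xy)  = inj₂ xy
  base-hom {inj₁ _} {inj₂ _} (inj₂ x≡y) = inj₁ x≡y
  base-hom {inj₂ _} {inj₁ _} (inj₂ x≡y) = inj₁ x≡y
  base-hom {inj₂ _} {inj₂ _} (inj₂ ())

  leaf-neighbours : ∀ {v r} → N[ M ℓ ]∋ (inj₂ v) r → r ≡ inj₁ v ⊎ r ≡ inj₂ v
  leaf-neighbours (inj₁ refl)              = inj₂ refl
  leaf-neighbours {r = inj₁ _} (inj₂ refl) = inj₁ refl
  leaf-neighbours {r = inj₂ _} (inj₂ ())

  base-from-leaf : ∀ {v r} → N[ M ℓ ]∋ (inj₂ v) r → base r ≡ v
  base-from-leaf = [ cong base , cong base ]′ ∘ leaf-neighbours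

  base-to-leaf : ∀ {v r} → N[ M ℓ ]∋ r (inj₂ v) → base r ≡ v
  base-to-leaf (inj₁ refl)              = refl
  base-to-leaf {r = inj₁ _} (inj₂ refl) = refl
  base-to-leaf {r = inj₂ _} (inj₂ ())

  root : Base ℓ → Fin 4
  root (cyc x)   = x
  root (pth a _) = inject₁ a

  root-hom : Homomorphism (M′ ℓ) C₄ root
  root-hom (inj₁ refl)                = inj₁ refl
  root-hom (inj₂ (inj₁ c01))          = inj₂ (inj₁ e01)
  root-hom (inj₂ (inj₁ c12))          = inj₂ (inj₁ e12)
  root-hom (inj₂ (inj₁ c23))          = inj₂ (inj₁ e23)
  root-hom (inj₂ (inj₁ c30))          = inj₂ (inj₁ e30)
  root-hom (inj₂ (inj₂ c01))          = inj₂ (inj₂ e01)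
  root-hom (inj₂ (inj₂ c12))          = inj₂ (inj₂ e12)
  root-hom (inj₂ (inj₂ c23))          = inj₂ (inj₂ e23)
  root-hom (inj₂ (inj₂ c30))          = inj₂ (inj₂ e30)
  root-hom (inj₂ (inj₁ (pp _ _ _ _))) = inj₁ refl
  root-hom (inj₂ (inj₂ (pp _ _ _ _))) = inj₁ refl
  root-hom (inj₂ (inj₁ (att _ _ _)))  = inj₁ refl
  root-hom (inj₂ (inj₂ (att _ _ _)))  = inj₁ refl

  cycle-hom : Homomorphism C₄ (M ℓ) (inj₁ ∘ cyc)
  cycle-hom (inj₁ refl)       = inj₁ refl
  cycle-hom (inj₂ (inj₁ e01)) = inj₂ (inj₁ c01)
  cycle-hom (inj₂ (inj₁ e12)) = inj₂ (inj₁ c12)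
  cycle-hom (inj₂ (inj₁ e23)) = inj₂ (inj₁ c23)
  cycle-hom (inj₂ (inj₁ e30)) = inj₂ (inj₁ c30)
  cycle-hom (inj₂ (inj₂ e01)) = inj₂ (inj₂ c01)
  cycle-hom (inj₂ (inj₂ e12)) = inj₂ (inj₂ c12)
  cycle-hom (inj₂ (inj₂ e23)) = inj₂ (inj₂ c23)
  cycle-hom (inj₂ (inj₂ e30)) = inj₂ (inj₂ c30)

  one-cop-loses : ¬ CanCapture (M ℓ) 1
  one-cop-loses = retract-C₄⇒one-cop-loses (root ∘ base) (inj₁ ∘ cyc)
                    (root-hom ∘ base-hom) cycle-hom (λ _ → refl)

  depth : Base ℓ → ℕ
  depth (cyc _)   = 0
  depth (pth _ i) = suc (toℕ i)

  depth-edge : ∀ {x y} → E ℓ x y → depth y ≤ suc (depth x) × depth x ≤ suc (depth y)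
  depth-edge c01 = z≤n , z≤n
  depth-edge c12 = z≤n , z≤n
  depth-edge c23 = z≤n , z≤n
  depth-edge c30 = z≤n , z≤n
  depth-edge (pp _ _ _ j≡1+i) rewrite j≡1+i = ≤-refl , m≤n⇒m≤1+n (n≤1+n _)
  depth-edge (att _ _ i≡0)    rewrite i≡0   = z≤n , ≤-refl

  depth-lipschitz : Lipschitz (M′ ℓ) depth
  depth-lipschitz (inj₁ refl)      = n≤1+n _
  depth-lipschitz (inj₂ (inj₁ xy)) = proj₁ (depth-edge xy)
  depth-lipschitz (inj₂ (inj₂ yx)) = proj₂ (depth-edge yx)

  depth-at-root-change : ∀ {x y} → N[ M′ ℓ ]∋ x y → root x ≢ root y → depth y ≡ 0
  depth-at-root-change {y = cyc _} _ _              = refl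
  depth-at-root-change (inj₁ refl)                ne = contradiction refl ne
  depth-at-root-change (inj₂ (inj₁ (pp _ _ _ _))) ne = contradiction refl ne
  depth-at-root-change (inj₂ (inj₂ (pp _ _ _ _))) ne = contradiction refl ne
  depth-at-root-change (inj₂ (inj₂ (att _ _ _)))  ne = contradiction refl ne

  depth-over-3 : ∀ {v} → root v ≡ # 3 → depth v ≡ 0
  depth-over-3 {cyc _}                     _  = refl
  depth-over-3 {pth fzero _}               ()
  depth-over-3 {pth (fsuc fzero) _}        ()
  depth-over-3 {pth (fsuc (fsuc fzero)) _} ()

  corner-neighbours : ∀ {r} → N[ M ℓ ]∋ (inj₁ (cyc (# 3))) r → depth (base r) ≡ 0
  corner-neighbours {r} n with root (base r) Fin.≟ # 3
  ... | yes over3 = depth-over-3 over3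
  ... | no ¬over3 = depth-at-root-change (base-hom n) (¬over3 ∘ sym)

  level : V (M ℓ) → ℕ
  level (inj₁ v) = depth v
  level (inj₂ v) = suc (depth v)

  level-lipschitz : Lipschitz (M ℓ) level
  level-lipschitz (inj₁ refl)                   = n≤1+n _
  level-lipschitz {inj₁ _} {inj₁ _} (inj₂ xy)   = depth-lipschitz (inj₂ xy)
  level-lipschitz {inj₁ _} {inj₂ _} (inj₂ refl) = ≤-refl
  level-lipschitz {inj₂ _} {inj₁ _} (inj₂ refl) = m≤n⇒m≤1+n (n≤1+n _)
  level-lipschitz {inj₂ _} {inj₂ _} (inj₂ ())

  level-at-root-change : ∀ {u v} → N[ M ℓ ]∋ u v → root (base u) ≢ root (base v) → level v ≡ 0
  level-at-root-change {v = inj₁ _} uv ne = depth-at-root-change (base-hom uv) ne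
  level-at-root-change {v = inj₂ _} uv ne = contradiction (cong root (base-to-leaf uv)) ne

  fibreHeight : Fin 4 → V (M ℓ) → ℕ
  fibreHeight x r = if does (root (base r) Fin.≟ x) then suc (level r) else 0

  fibreHeight-lipschitz : ∀ x → Lipschitz (M ℓ) (fibreHeight x)
  fibreHeight-lipschitz x {u} {v} uv with root (base u) Fin.≟ x | root (base v) Fin.≟ x
  ... | _      | no _     = z≤n
  ... | yes _  | yes _    = s≤s (level-lipschitz uv)
  ... | no u∉x | yes refl = s≤s (≤-reflexive (level-at-root-change uv u∉x))

  fibreHeight-support : ∀ x r → 0 < fibreHeight x r → root (base r) ≡ x
  fibreHeight-support x r positive with root (base r) Fin.≟ x
  ... | yes on = on
  ... | no _   = contradiction positive n≮0

  fibreHeight-leg-end : ∀ a (i : Fin ℓ) → fibreHeight (inject₁ a) (inj₂ (pth a i)) ≡ 3 + toℕ i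
  fibreHeight-leg-end a i with inject₁ a Fin.≟ inject₁ a
  ... | yes _ = refl
  ... | no ≢  = contradiction refl ≢

  two-cops-rounds : ∀ (i : Fin ℓ) (S : Fin 2 → V (M ℓ)) t → CaptLe (M ℓ) S t → 3 + toℕ i ≤ t
  two-cops-rounds i S t capt = ≮⇒≥ λ fast → two-legs-one-cop (guard fast)
    where
    guard : t < 3 + toℕ i → ∀ a → ∃[ z ] root (base (S z)) ≡ inject₁ a
    guard fast a with winWithin⇒lipschitz-bound (fibreHeight-lipschitz (inject₁ a)) t
                        (capt (inj₂ (pth a i)))
    ... | z , reach = z , fibreHeight-support (inject₁ a) (S z)
                            (positive (subst (_≤ _ + t) (fibreHeight-leg-end a i) reach))
      where
      positive : ∀ {n} → 3 + toℕ i ≤ n + t → 0 < n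
      positive {zero}  reach = contradiction reach (<⇒≱ fast)
      positive {suc _} _     = z<s
    two-legs-one-cop : (∀ a → ∃[ z ] root (base (S z)) ≡ inject₁ a) → ⊥
    two-legs-one-cop on with Fin.pigeonhole (n<1+n 2) (proj₁ ∘ on)
    ... | a , b , a<b , same = Fin.<⇒≢ a<b (Fin.inject₁-injective
          (trans (sym (proj₂ (on a))) (trans (cong (root ∘ base ∘ S) same) (proj₂ (on b)))))

  domination-bound : ∀ {d} {S : Fin d → V (M ℓ)} → Dominating (M ℓ) S → 3 * ℓ ≤ d
  domination-bound {d} {S} dom = Fin.injective⇒≤ dominator-injective
    where
    leafBase : Fin (3 * ℓ) → Base ℓ
    leafBase = uncurry pth ∘ remQuot ℓ
    dominator : Fin (3 * ℓ) → Fin d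
    dominator k = proj₁ (dom (inj₂ (leafBase k)))
    dominates : ∀ k → base (S (dominator k)) ≡ leafBase k
    dominates k = base-to-leaf (proj₂ (dom (inj₂ (leafBase k))))
    pth-injective : ∀ {a b i j} → pth {ℓ} a i ≡ pth b j → (a , i) ≡ (b , j)
    pth-injective refl = refl
    dominator-injective : Injective _≡_ _≡_ dominator
    dominator-injective {k} {k′} same =
      trans (sym (Fin.combine-remQuot ℓ k))
        (trans (cong (uncurry combine) (pth-injective
                  (trans (sym (dominates k)) (trans (cong (base ∘ S) same) (dominates k′)))))
          (Fin.combine-remQuot ℓ k′))

  onLeg : Fin 3 → (n : ℕ) → n ≤ ℓ → Base ℓ
  onLeg a zero    _ = cyc (inject₁ a)
  onLeg a (suc n) p = pth a (fromℕ< p)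

  onLeg-pth : ∀ {a n i} (p : n ≤ ℓ) → n ≡ suc (toℕ i) → onLeg a n p ≡ pth a i
  onLeg-pth {n = suc n} p n≡1+i =
    cong (pth _) (Fin.toℕ-injective (trans (Fin.toℕ-fromℕ< p) (suc-injective n≡1+i)))

  onLeg-below : ∀ {a n i} (p : n ≤ ℓ) → toℕ i ≡ n → Adj (M′ ℓ) (onLeg a n p) (pth a i)
  onLeg-below {n = zero}  p i≡0 = inj₂ (att _ _ i≡0)
  onLeg-below {n = suc n} p i≡n = inj₁ (pp _ _ _ (trans i≡n (cong suc (sym (Fin.toℕ-fromℕ< p)))))

  onLeg-ascend : ∀ {a n} (p : n ≤ ℓ) (p′ : suc n ≤ ℓ) → Adj (M′ ℓ) (onLeg a n p) (onLeg a (suc n) p′)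
  onLeg-ascend p p′ = onLeg-below p (Fin.toℕ-fromℕ< p′)

  copsAt : (n : ℕ) → n ≤ ℓ → Fin 3 → V (M ℓ)
  copsAt n p a = inj₁ (onLeg a n p)

  -- The robber is on leg a strictly beyond onLeg a n, a leaf counting as beyond its vertex.
  data Above (a : Fin 3) : ℕ → V (M ℓ) → Set where
    vertex    : ∀ {n i} → n ≤ toℕ i → Above a n (inj₁ (pth a i))
    leaf      : ∀ {n i} → n ≤ suc (toℕ i) → Above a n (inj₂ (pth a i))
    root-leaf : Above a 0 (inj₂ (cyc (inject₁ a)))

  above-bound : ∀ {a n r} → Above a (suc n) r → suc n ≤ ℓ
  above-bound (vertex n<i) = <⇒≤ (≤-<-trans n<i (Fin.toℕ<n _))
  above-bound (leaf n≤i)   = ≤-trans n≤i (Fin.toℕ<n _)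

  adjacent-or-higher : ∀ {a n r} (p : n ≤ ℓ) → Above a n r →
    N[ M ℓ ]∋ (inj₁ (onLeg a n p)) r ⊎ Above a (suc n) r
  adjacent-or-higher p (vertex n≤i) with m≤n⇒m<n∨m≡n n≤i
  ... | inj₁ n<i  = inj₂ (vertex n<i)
  ... | inj₂ refl = inj₁ (inj₂ (onLeg-below p refl))
  adjacent-or-higher p (leaf n≤1+i) with m≤n⇒m<n∨m≡n n≤1+i
  ... | inj₁ n≤i   = inj₂ (leaf n≤i)
  ... | inj₂ n≡1+i = inj₁ (inj₂ (onLeg-pth p n≡1+i))
  adjacent-or-higher p root-leaf = inj₁ (inj₂ refl)

  above-closed : ∀ {a n r} (p : n ≤ ℓ) → Above a n r → ∀ {r′} → N[ M ℓ ]∋ r r′ →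
    r′ ≡ inj₁ (onLeg a n p) ⊎ Above a n r′
  above-closed p above (inj₁ refl) = inj₂ above
  above-closed p (vertex n≤i) {r′ = inj₂ _} (inj₂ refl) = inj₂ (leaf (m≤n⇒m≤1+n n≤i))
  above-closed p (vertex n≤i) {r′ = inj₁ _} (inj₂ (inj₁ (pp _ _ _ j≡1+i))) =
    inj₂ (vertex (subst (_ ≤_) (sym j≡1+i) (m≤n⇒m≤1+n n≤i)))
  above-closed p (vertex {n} n≤i) {r′ = inj₁ _} (inj₂ (inj₂ (pp _ _ _ i≡1+j)))
    with m≤n⇒m<n∨m≡n (subst (n ≤_) i≡1+j n≤i)
  ... | inj₁ n≤j   = inj₂ (vertex (s≤s⁻¹ n≤j))
  ... | inj₂ n≡1+j = inj₁ (cong inj₁ (sym (onLeg-pth p n≡1+j)))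
  above-closed p (vertex {n} n≤i) {r′ = inj₁ _} (inj₂ (inj₁ (att _ _ i≡0)))
    with n≤0⇒n≡0 (subst (n ≤_) i≡0 n≤i)
  ... | refl = inj₁ refl
  above-closed p (leaf {n} n≤1+i) {r′ = inj₁ _} (inj₂ refl) with m≤n⇒m<n∨m≡n n≤1+i
  ... | inj₁ n≤i   = inj₂ (vertex (s≤s⁻¹ n≤i))
  ... | inj₂ n≡1+i = inj₁ (cong inj₁ (sym (onLeg-pth p n≡1+i)))
  above-closed p (leaf _)  {r′ = inj₂ _} (inj₂ ())
  above-closed p root-leaf {r′ = inj₁ _} (inj₂ refl) = inj₁ refl
  above-closed p root-leaf {r′ = inj₂ _} (inj₂ ())

  climb : ∀ t {m} {C : Fin m → V (M ℓ)} {a n r} z (p : n ≤ ℓ) → C z ≡ inj₁ (onLeg a n p) →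
          Above a n r → suc ℓ ≤ n + t → WinWithin (M ℓ) t C r
  climb zero    z p _ _ late = contradiction (subst (suc ℓ ≤_) (+-identityʳ _) late) (≤⇒≯ p)
  climb (suc t) {C = C} {a} {n} z p at above late with adjacent-or-higher p above
  ... | inj₁ adjacent = adjacent⇒winWithin t z at adjacent
  ... | inj₂ higher   =
    chase t z (Above a (suc n)) at (inj₂ (onLeg-ascend p p′)) (above-closed p′ higher)
      (λ above′ → climb t z p′ (moveCop-moves {G = M ℓ} C z _) above′
                    (≤-trans late (≤-reflexive (+-suc n t))))
    where
    p′ = above-bound higher

  copsAt-descend : ∀ n (p : suc n ≤ ℓ) (p′ : n ≤ ℓ) → CopMove (M ℓ) (copsAt (suc n) p) (copsAt n p′)
  copsAt-descend n p p′ a = inj₂ (swap (onLeg-ascend p′ p))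

  descent-step : ∀ n (p : suc n ≤ ℓ) r → depth (base r) ≤ suc n →
    (∃[ a ] N[ M ℓ ]∋ (copsAt (suc n) p a) r) ⊎ (∀ {r′} → N[ M ℓ ]∋ r r′ → depth (base r′) ≤ n)
  descent-step n p (inj₂ v) below with m≤n⇒m<n∨m≡n below
  ... | inj₁ (s≤s shallow) =
    inj₂ λ rr′ → subst (λ w → depth w ≤ n) (sym (base-from-leaf rr′)) shallow
  descent-step n p (inj₂ (pth a i)) below | inj₂ deepest = inj₁ (a , inj₂ (onLeg-pth p (sym deepest)))
  descent-step n p (inj₁ (pth a i)) below with m≤n⇒m<n∨m≡n below
  ... | inj₂ deepest = inj₁ (a , inj₁ (cong inj₁ (onLeg-pth p (sym deepest))))
  ... | inj₁ (s≤s shallow) with m≤n⇒m<n∨m≡n shallow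
  ...   | inj₂ next-to-cop =
          inj₁ (a , inj₂ (inj₂ (pp _ _ _ (trans (Fin.toℕ-fromℕ< p) (sym next-to-cop)))))
  ...   | inj₁ deeper = inj₂ λ rr′ → ≤-trans (depth-lipschitz (base-hom rr′)) deeper
  descent-step (suc n) p (inj₁ (cyc _)) _ =
    inj₂ λ rr′ → ≤-trans (depth-lipschitz (base-hom rr′)) (s≤s z≤n)
  descent-step zero p (inj₁ (cyc fzero)) _ =
    inj₁ (# 0 , inj₂ (inj₁ (att _ _ (Fin.toℕ-fromℕ< p))))
  descent-step zero p (inj₁ (cyc (fsuc fzero))) _ =
    inj₁ (# 1 , inj₂ (inj₁ (att _ _ (Fin.toℕ-fromℕ< p))))
  descent-step zero p (inj₁ (cyc (fsuc (fsuc fzero)))) _ =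
    inj₁ (# 2 , inj₂ (inj₁ (att _ _ (Fin.toℕ-fromℕ< p))))
  descent-step zero p (inj₁ (cyc (fsuc (fsuc (fsuc fzero))))) _ =
    inj₂ λ rr′ → ≤-reflexive (corner-neighbours rr′)

  cycle-endgame : ∀ r → depth (base r) ≤ 0 → WinWithin (M ℓ) 2 (copsAt 0 z≤n) r
  cycle-endgame (inj₁ (cyc fzero))                      _ = inj₁ (# 0 , refl)
  cycle-endgame (inj₁ (cyc (fsuc fzero)))               _ = inj₁ (# 1 , refl)
  cycle-endgame (inj₁ (cyc (fsuc (fsuc fzero))))        _ = inj₁ (# 2 , refl)
  cycle-endgame (inj₁ (cyc (fsuc (fsuc (fsuc fzero))))) _ = adjacent⇒winWithin 1 (# 0) refl (inj₂ (inj₂ c30))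
  cycle-endgame (inj₂ (cyc fzero))                      _ = adjacent⇒winWithin 1 (# 0) refl (inj₂ refl)
  cycle-endgame (inj₂ (cyc (fsuc fzero)))               _ = adjacent⇒winWithin 1 (# 1) refl (inj₂ refl)
  cycle-endgame (inj₂ (cyc (fsuc (fsuc fzero))))        _ = adjacent⇒winWithin 1 (# 2) refl (inj₂ refl)
  cycle-endgame (inj₂ (cyc (fsuc (fsuc (fsuc fzero))))) _ =
    chase 1 (# 0) (_≡ corner) refl (inj₂ (inj₂ c30)) leaf-neighbours λ where
      refl → adjacent⇒winWithin {G = M ℓ} 0 (# 0)
               (moveCop-moves {G = M ℓ} (copsAt 0 z≤n) (# 0) _) (inj₂ refl)
    where
    corner : V (M ℓ)
    corner = inj₂ (cyc (# 3))

  descend : ∀ n (p : n ≤ ℓ) r → depth (base r) ≤ n → WinWithin (M ℓ) (2 + n) (copsAt n p) r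
  descend zero    p r below = cycle-endgame r below
  descend (suc n) p r below with descent-step n p r below
  ... | inj₁ (a , adjacent) = adjacent⇒winWithin (2 + n) a refl adjacent
  ... | inj₂ trapped =
    inj₂ (copsAt n p′ , copsAt-descend n p p′ , inj₂ λ r′ rr′ → descend n p′ r′ (trapped rr′))
    where
    p′ = ≤-trans (n≤1+n n) p

  below-or-above : ∀ n r → depth (base r) ≤ n ⊎ ∃[ a ] Above a n r
  below-or-above n (inj₁ (cyc _)) = inj₁ z≤n
  below-or-above n (inj₂ (cyc _)) = inj₁ z≤n
  below-or-above n (inj₁ (pth a i)) with suc (toℕ i) ≤? n
  ... | yes below = inj₁ below
  ... | no above  = inj₂ (a , vertex (s≤s⁻¹ (≰⇒> above)))
  below-or-above n (inj₂ (pth a i)) with suc (toℕ i) ≤? n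
  ... | yes below = inj₁ below
  ... | no above  = inj₂ (a , leaf (<⇒≤ (≰⇒> above)))

  three-cops-capture : ∀ n (p : n ≤ ℓ) t → 2 + n ≤ t → suc ℓ ≤ n + t → CaptLe (M ℓ) (copsAt n p) t
  three-cops-capture n p t descent-time climb-time r with below-or-above n r
  ... | inj₁ below       = winWithin-mono descent-time (descend n p r below)
  ... | inj₂ (a , above) = climb t a p refl above climb-time

  twoCops : Fin 2 → V (M ℓ)
  twoCops fzero        = inj₁ (cyc (# 1))
  twoCops (fsuc fzero) = inj₁ (cyc (# 3))

  hub-adjacent : ∀ a → N[ M ℓ ]∋ (inj₁ (cyc (# 1))) (inj₁ (cyc (inject₁ a)))
  hub-adjacent fzero               = inj₂ (inj₂ c01)
  hub-adjacent (fsuc fzero)        = inj₁ refl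
  hub-adjacent (fsuc (fsuc fzero)) = inj₂ (inj₁ c12)

  enter-leg : ∀ a {r} → Above a 0 r → WinWithin (M ℓ) (3 + ℓ) twoCops r
  enter-leg a above =
    chase (2 + ℓ) (# 0) (Above a 0) refl (hub-adjacent a) (above-closed z≤n above)
      (λ above′ → climb (2 + ℓ) (# 0) z≤n (moveCop-moves {G = M ℓ} twoCops (# 0) _) above′
                    (n≤1+n _))

  two-cops-capture : CaptLe (M ℓ) twoCops (3 + ℓ)
  two-cops-capture (inj₁ (cyc fzero))                      = adjacent⇒winWithin _ (# 0) refl (inj₂ (inj₂ c01))
  two-cops-capture (inj₁ (cyc (fsuc fzero)))               = inj₁ (# 0 , refl)
  two-cops-capture (inj₁ (cyc (fsuc (fsuc fzero))))        = adjacent⇒winWithin _ (# 0) refl (inj₂ (inj₁ c12))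
  two-cops-capture (inj₁ (cyc (fsuc (fsuc (fsuc fzero))))) = inj₁ (# 1 , refl)
  two-cops-capture (inj₂ (cyc fzero))                      = enter-leg (# 0) root-leaf
  two-cops-capture (inj₂ (cyc (fsuc fzero)))               = enter-leg (# 1) root-leaf
  two-cops-capture (inj₂ (cyc (fsuc (fsuc fzero))))        = enter-leg (# 2) root-leaf
  two-cops-capture (inj₂ (cyc (fsuc (fsuc (fsuc fzero))))) = adjacent⇒winWithin _ (# 1) refl (inj₂ refl)
  two-cops-capture (inj₁ (pth a _))                        = enter-leg a (vertex z≤n)
  two-cops-capture (inj₂ (pth a _))                        = enter-leg a (leaf z≤n)

  copNumber : IsCopNumber (M ℓ) 2
  copNumber = (twoCops , 3 + ℓ , two-cops-capture) , fewer-lose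
    where
    fewer-lose : ∀ c → c < 2 → ¬ CanCapture (M ℓ) c
    fewer-lose zero          _ = zero-cops-lose (inj₁ (cyc (# 0)))
    fewer-lose (suc zero)    _ = one-cop-loses
    fewer-lose (suc (suc _)) (s≤s (s≤s ()))

-- Parameters of the three-cop strategy

record GapParameters (ℓ : ℕ) : Set where
  field
    startDepth rounds : ℕ
    startDepth≤ℓ      : startDepth ≤ ℓ
    descent-time      : 2 + startDepth ≤ rounds
    climb-time        : suc ℓ ≤ startDepth + rounds
    beats-domination  : suc rounds < ℓ
    beats-two-cops    : 3 * suc rounds < 2 * (3 + ℓ)

widen : ∀ {ℓ} → GapParameters ℓ → GapParameters (2 + ℓ)
widen {ℓ} params = record
  { startDepth       = suc startDepth
  ; rounds           = suc rounds
  ; startDepth≤ℓ     = s≤s (m≤n⇒m≤1+n startDepth≤ℓ)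
  ; descent-time     = s≤s descent-time
  ; climb-time       = ≤-trans (s≤s (s≤s climb-time))
                               (≤-reflexive (cong suc (sym (+-suc startDepth rounds))))
  ; beats-domination = s≤s (m<n⇒m<1+n beats-domination)
  ; beats-two-cops   = begin-strict
      3 * suc (suc rounds)   ≡⟨ *-suc 3 (suc rounds) ⟩
      3 + 3 * suc rounds     <⟨ +-monoʳ-< 3 beats-two-cops ⟩
      3 + 2 * (3 + ℓ)        <⟨ n<1+n _ ⟩
      4 + 2 * (3 + ℓ)        ≡⟨ *-distribˡ-+ 2 2 (3 + ℓ) ⟨
      2 * (5 + ℓ)            ∎
  }
  where
  open GapParameters params
  open ≤-Reasoning

gap-parameters : ∀ n → GapParameters (7 + n)
gap-parameters 0 = record
  { startDepth = 3 ; rounds = 5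
  ; startDepth≤ℓ = from-yes (3 ≤? 7) ; descent-time = ≤-refl ; climb-time = ≤-refl
  ; beats-domination = from-yes (6 <? 7) ; beats-two-cops = from-yes (3 * 6 <? 2 * 10) }
gap-parameters 1 = record
  { startDepth = 3 ; rounds = 6
  ; startDepth≤ℓ = from-yes (3 ≤? 8) ; descent-time = n≤1+n 5 ; climb-time = ≤-refl
  ; beats-domination = from-yes (7 <? 8) ; beats-two-cops = from-yes (3 * 7 <? 2 * 11) }
gap-parameters (suc (suc n)) = widen (gap-parameters n)

theorem4p7 : (ℓ : ℕ) → 7 ≤ ℓ → (g c : ℕ) →
    IsDominationNumber (M ℓ) g → IsCopNumber (M ℓ) c →
    ThkGtTh (M ℓ) g × ThkGtTh (M ℓ) c
theorem4p7 ℓ@(suc n) 7≤ℓ g c ((_ , dominating) , _) isCopNumber =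
  (cost , three-cops , slow-γ) , (cost , three-cops , slow-c)
  where
  open GapParameters (subst GapParameters (m+[n∸m]≡n 7≤ℓ) (gap-parameters (ℓ ∸ 7)))
  cost = 3 * suc rounds
  three-cops : ThLe (M ℓ) cost
  three-cops = 3 , copsAt startDepth startDepth≤ℓ , rounds ,
               three-cops-capture startDepth startDepth≤ℓ rounds descent-time climb-time , ≤-refl
  slow-γ : ¬ ThkLe (M ℓ) g cost
  slow-γ = thk-lower-bound (λ _ t _ → ≤-trans (domination-bound dominating) (m≤m*n g (suc t)))
                           (*-monoʳ-< 3 beats-domination)
  two-cops-slow : ∀ S t → CaptLe (M ℓ) S t → 2 + ℓ ≤ t
  two-cops-slow S t capt =
    subst (_≤ t) (cong (3 +_) (Fin.toℕ-fromℕ n)) (two-cops-rounds (fromℕ n) S t capt)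
  slow-c : ¬ ThkLe (M ℓ) c cost
  slow-c = subst (λ k → ¬ ThkLe (M ℓ) k cost) (isCopNumber-unique copNumber isCopNumber)
             (thk-lower-bound (λ S t capt → *-monoʳ-≤ 2 (s≤s (two-cops-slow S t capt))) beats-two-cops)
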